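{- Let $G$ be a graph with win partition $\alpha=\{\alpha_1,\alpha_2,\dots,\alpha_k\}$. If $w\in\alpha_{k-1}\cup\alpha_k$, then for every configuration $C_0$ of $G$ the $w$-power index process with initial configuration $C_0$ eventually becomes stable.
   Context: All graphs are finite and simple. A configuration of a graph $G$ is a map $C:V(G)\to\{C,D\}$; vertices with value $C$ are collaborators, those with value $D$ defectors. $N[v]$ is the closed neighbourhood of $v$, $N_C[v]$ is the set of collaborators in $N[v]$ and $N_D[v]$ the set of defectors in $N[v]$. For a win condition $w\in\left[\frac12,1\right)$, the power of $v$ with respect to a configuration is: if $v$ is a collaborator, $p(v)=1/|N_C[v]|$ when $|N_C[v]|/|N[v]|>w$ and $p(v)=0$ otherwise; if $v$ is a defector, $p(v)=1/|N_D[v]|$ when $|N_C[v]|/|N[v]|\le w$ and $p(v)=0$ otherwise. The $w$-power index process with initial configuration $C_0$ produces configurations $C_1,C_2,\dots$: for $t\ge1$ each vertex $v$ simultaneously takes the strategy that, in $C_{t-1}$, is held by the vertex of $N[v]$ of greatest power (powers computed with respect to $C_{t-1}$); if the vertices of $N[v]$ of greatest power have differing strategies, then $C_t(v)=C_{t-1}(v)$. The process becomes stable if there is $i\ge0$ with $C_i=C_{i+1}$. Win partition: for $v\in V(G)$ let $S_v=\{i/|N[v]| : i\in\mathbb Z,\ |N[v]|/2\le i\le |N[v]|\}$ and $S_G=\bigcup_{v\in V(G)}S_v$. Writing $S_G=\{s_1<s_2<\dots<s_{|S_G|}\}$, the win partition of $G$ is $\{[\tfrac12,s_1),[s_1,s_2),\dots,[s_{|S_G|-1},s_{|S_G|})\}$,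 a partition of $[\tfrac12,1)$, whose parts are indexed in increasing order.
   Formalization: The win condition w takes only rational values in $\left[\frac12,1\right)$. -}

module Defs where

open import Data.Bool using (Bool; true; false; _∧_; _∨_; not; if_then_else_)
open import Data.Nat as ℕ using (ℕ; zero; suc)
open import Data.Fin using (Fin)
import Data.Fin.Properties as FinP
open import Data.List using (List; []; _∷_; filter; foldr; length; allFin)
open import Data.Bool.ListAction using (any)
open import Data.Integer using (+_)
open import Data.Rational using (ℚ; _/_; _≤_; _<_; _⊔_; 0ℚ; ½; 1ℚ)
open import Data.Rational.Properties using (_≤?_; _<?_) renaming (_≟_ to _≟ℚ_)
open import Data.Product using (Σ; ∃; _×_; _,_)
open import Relation.Nullary.Decidable using (⌊_⌋; yes; no)
open import Relation.Binary.PropositionalEquality using (_≡_)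

record Graph (n : ℕ) : Set where
  field
    adj   : Fin n → Fin n → Bool
    sym   : ∀ u v → adj u v ≡ adj v u
    irrefl : ∀ v → adj v v ≡ false
open Graph public

data Strategy : Set where
  C D : Strategy

isC : Strategy → Bool
isC C = true
isC D = false

isD : Strategy → Bool
isD s = not (isC s)

Configuration : ℕ → Set
Configuration n = Fin n → Strategy

count : ∀ {n} → (Fin n → Bool) → ℕ
count {n} P = length (filter (λ u → P u Data.Bool.≟ true) (allFin n))

closedNbhd : ∀ {n} → Graph n → Fin n → List (Fin n)
closedNbhd {n} G v =
  filter (λ u → Data.Bool._≟_ (⌊ u FinP.≟ v ⌋ ∨ adj G v u) true) (allFin n)

closedDeg : ∀ {n} → Graph n → Fin n → ℕ
closedDeg G v = suc (count (adj G v))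

numC : ∀ {n} → Graph n → Configuration n → Fin n → ℕ
numC G c v = (if isC (c v) then 1 else 0) ℕ.+ count (λ u → adj G v u ∧ isC (c u))

ratioC : ∀ {n} → Graph n → Configuration n → Fin n → ℚ
ratioC G c v = (+ numC G c v) / closedDeg G v

-- power of v (with respect to configuration c and win condition w).
-- For a collaborator v, |N_C[v]| = 1 + #collaborating neighbours;
-- for a defector v, |N_D[v]| = 1 + #defecting neighbours.
power : ∀ {n} → Graph n → ℚ → Configuration n → Fin n → ℚ
power G w c v with c v
... | C with w <? ratioC G c v
...   | yes _ = (+ 1) / suc (count (λ u → adj G v u ∧ isC (c u)))
...   | no  _ = 0ℚ
power G w c v | D with ratioC G c v ≤? w
...   | yes _ = (+ 1) / suc (count (λ u → adj G v u ∧ isD (c u)))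
...   | no  _ = 0ℚ

maxPower : ∀ {n} → Graph n → ℚ → Configuration n → Fin n → ℚ
maxPower G w c v = foldr (λ u m → power G w c u ⊔ m) 0ℚ (closedNbhd G v)

maxHolds : ∀ {n} → Graph n → ℚ → Configuration n → Fin n → (Strategy → Bool) → Bool
maxHolds G w c v s =
  any (λ u → ⌊ power G w c u ≟ℚ maxPower G w c v ⌋ ∧ s (c u)) (closedNbhd G v)

step : ∀ {n} → Graph n → ℚ → Configuration n → Configuration n
step G w c v with maxHolds G w c v isC | maxHolds G w c v isD
... | true  | false = C
... | false | true  = D
... | _     | _     = c v

process : ∀ {n} → Graph n → ℚ → Configuration n → ℕ → Configuration n
process G w c zero    = c
process G w c (suc t) = step G w (process G w c t)

BecomesStable : ∀ {n} → Graph n → ℚ → Configuration n → Set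
BecomesStable G w c0 = ∃ λ i → ∀ v → process G w c0 i v ≡ process G w c0 (suc i) v

InS : ∀ {n} → Graph n → ℚ → Set
InS G t = Σ _ λ v → Σ ℕ λ i →
  (closedDeg G v ℕ.≤ 2 ℕ.* i) × (i ℕ.≤ closedDeg G v) × (t ≡ (+ i) / closedDeg G v)

-- Writing S_G = {s_1 < … < s_k} (s_k = 1), α_{k-1} ∪ α_k = [s_{k-2}, 1)
-- (with s_0 = 1/2, and = [1/2,1) = α_1 when k = 1).  s_{k-2} is the element
-- of S_G having exactly two elements of S_G above it, so the condition is:
-- 1/2 ≤ w < 1 and w ≥ every element of S_G that has two larger elements of S_G.
InLastTwoParts : ∀ {n} → Graph n → ℚ → Set
InLastTwoParts G w =
  (½ ≤ w) × (w < 1ℚ) ×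
  (∀ t → InS G t →
     (Σ ℚ λ t₁ → Σ ℚ λ t₂ → InS G t₁ × InS G t₂ × (t < t₁) × (t₁ < t₂)) →
     t ≤ w)

-- A defector v with |N_C[v]|/|N[v]| ≤ w (a winning defector) has the largest power in N[v]: a
-- collaborator beating it would have to be a winning collaborator with a defecting
-- neighbour, and when w lies in the last two parts of the win partition such a
-- collaborator has exactly one defecting neighbour and maximum degree, so its power
-- 1/|N_C| is at most 1/|N_D[v]|.  Hence winning defectors stay defectors and stay
-- winning, and a collaborator that defects becomes a winning defector.  Weighting
-- collaborators 1, winning defectors 0 and losing defectors 2, the total weight
-- strictly decreases at every step that changes the configuration.

module Submission where

open import Defs hiding (sym)
open import Data.Bool as Bool using (Bool; true; false; _∧_; _∨_)
import Data.Bool.Properties as Bool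
open import Data.Fin using (Fin)
import Data.Fin.Properties as Fin
open import Data.Integer as ℤ using (+_)
import Data.Integer.Properties as ℤ
open import Data.List using (List; []; _∷_; filter; foldr; length; allFin; map)
open import Data.List.Membership.Propositional using (_∈_; lose; find)
open import Data.List.Membership.Propositional.Properties using (∈-allFin; ∈-filter⁺; ∈-filter⁻)
open import Data.List.Relation.Unary.Any using (here; there)
open import Data.List.Relation.Unary.Any.Properties using (any⁺; any⁻)
open import Data.Nat as ℕ using (ℕ; zero; suc; z≤n; s≤s; NonZero)
open import Data.Nat.ListAction using (sum)
import Data.Nat.Properties as ℕ
open import Data.Product using (∃; _×_; _,_; proj₁; proj₂)
open import Data.Rational using (ℚ; _/_; _≤_; _<_; 0ℚ; ½; _⊔_)
import Data.Rational.Properties as ℚ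
import Data.Rational.Unnormalised as ℚᵘ
import Data.Rational.Unnormalised.Properties as ℚᵘ
open import Data.Sum using (_⊎_; inj₁; inj₂; [_,_]′)
open import Function.Bundles using (Equivalence)
open import Relation.Binary.PropositionalEquality
open import Relation.Nullary using (Dec; yes; no; ¬_; contradiction)
open import Relation.Nullary.Decidable using (⌊_⌋; fromWitness; toWitness)

open Equivalence using (to; from)

frac-≤ : ∀ a b d e .{{_ : NonZero d}} .{{_ : NonZero e}} →
         a ℕ.* e ℕ.≤ b ℕ.* d → (+ a) / d ≤ (+ b) / e
frac-≤ a b (suc k) (suc l) ae≤bd = ℚ.toℚᵘ-cancel-≤
  (ℚᵘ.≤-respˡ-≃ (ℚᵘ.≃-sym (ℚ.toℚᵘ-fromℚᵘ (ℚᵘ.mkℚᵘ (+ a) k)))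
  (ℚᵘ.≤-respʳ-≃ (ℚᵘ.≃-sym (ℚ.toℚᵘ-fromℚᵘ (ℚᵘ.mkℚᵘ (+ b) l)))
  (ℚᵘ.*≤* (subst₂ ℤ._≤_ (ℤ.pos-* a (suc l)) (ℤ.pos-* b (suc k)) (ℤ.+≤+ ae≤bd)))))

frac-< : ∀ a b d e .{{_ : NonZero d}} .{{_ : NonZero e}} →
         a ℕ.* e ℕ.< b ℕ.* d → (+ a) / d < (+ b) / e
frac-< a b (suc k) (suc l) ae<bd = ℚ.toℚᵘ-cancel-<
  (ℚᵘ.<-respˡ-≃ (ℚᵘ.≃-sym (ℚ.toℚᵘ-fromℚᵘ (ℚᵘ.mkℚᵘ (+ a) k)))
  (ℚᵘ.<-respʳ-≃ (ℚᵘ.≃-sym (ℚ.toℚᵘ-fromℚᵘ (ℚᵘ.mkℚᵘ (+ b) l)))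
  (ℚᵘ.*<* (subst₂ ℤ._<_ (ℤ.pos-* a (suc l)) (ℤ.pos-* b (suc k)) (ℤ.+<+ ae<bd)))))

frac-monoˡ-≤ : ∀ {a b} d .{{_ : NonZero d}} → a ℕ.≤ b → (+ a) / d ≤ (+ b) / d
frac-monoˡ-≤ {a} {b} d a≤b = frac-≤ a b d d (ℕ.*-monoˡ-≤ d a≤b)

frac-monoˡ-< : ∀ {a b} d .{{_ : NonZero d}} → a ℕ.< b → (+ a) / d < (+ b) / d
frac-monoˡ-< {a} {b} d a<b = frac-< a b d d (ℕ.*-monoˡ-< d a<b)

frac-nonneg : ∀ a d .{{_ : NonZero d}} → 0ℚ ≤ (+ a) / d
frac-nonneg a d = frac-≤ 0 a 1 d z≤n

1/suc-antitone : ∀ {a b} → a ℕ.≤ b → (+ 1) / suc b ≤ (+ 1) / suc a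
1/suc-antitone {a} {b} a≤b = frac-≤ 1 1 (suc b) (suc a)
  (subst₂ ℕ._≤_ (sym (ℕ.*-identityˡ (suc a))) (sym (ℕ.*-identityˡ (suc b))) (s≤s a≤b))

n/suc-n-strictMono : ∀ {a b} → a ℕ.< b → (+ a) / suc a < (+ b) / suc b
n/suc-n-strictMono {a} {b} a<b = frac-< a b (suc a) (suc b)
  (subst₂ ℕ._<_ (sym (ℕ.*-suc a b)) (sym (ℕ.*-suc b a))
    (ℕ.+-mono-<-≤ a<b (ℕ.≤-reflexive (ℕ.*-comm a b))))

frac<½ : ∀ j d .{{_ : NonZero d}} → ¬ (d ℕ.≤ 2 ℕ.* j) → (+ j) / d < ½
frac<½ j d d≰2j = frac-< j 1 d 2
  (subst₂ ℕ._<_ (ℕ.*-comm 2 j) (sym (ℕ.*-identityˡ d)) (ℕ.≰⇒> d≰2j))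

countIn : ∀ {A : Set} → (A → Bool) → List A → ℕ
countIn P xs = length (filter (λ x → P x Bool.≟ true) xs)

countIn-mono : ∀ {A : Set} (P Q : A → Bool) → (∀ x → P x ≡ true → Q x ≡ true) →
               ∀ xs → countIn P xs ℕ.≤ countIn Q xs
countIn-mono P Q P⇒Q [] = z≤n
countIn-mono P Q P⇒Q (x ∷ xs) with P x in px | Q x in qx
... | true  | true  = s≤s (countIn-mono P Q P⇒Q xs)
... | true  | false = contradiction (trans (sym (P⇒Q x px)) qx) λ ()
... | false | true  = ℕ.m≤n⇒m≤1+n (countIn-mono P Q P⇒Q xs)
... | false | false = countIn-mono P Q P⇒Q xs

countIn-mono-< : ∀ {A : Set} (P Q : A → Bool) → (∀ x → P x ≡ true → Q x ≡ true) →
                 ∀ {y} xs → y ∈ xs → Q y ≡ true → P y ≡ false → countIn P xs ℕ.< countIn Q xs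
countIn-mono-< P Q P⇒Q (x ∷ xs) (here refl) qx px rewrite qx | px =
  s≤s (countIn-mono P Q P⇒Q xs)
countIn-mono-< P Q P⇒Q (x ∷ xs) (there y∈xs) qy py with P x in px | Q x in qx
... | true  | true  = s≤s (countIn-mono-< P Q P⇒Q xs y∈xs qy py)
... | true  | false = contradiction (trans (sym (P⇒Q x px)) qx) λ ()
... | false | true  = ℕ.m≤n⇒m≤1+n (countIn-mono-< P Q P⇒Q xs y∈xs qy py)
... | false | false = countIn-mono-< P Q P⇒Q xs y∈xs qy py

maximum : ∀ {A : Set} → (A → ℚ) → List A → ℚ
maximum f = foldr (λ x m → f x ⊔ m) 0ℚ

≤-maximum : ∀ {A : Set} (f : A → ℚ) {x} xs → x ∈ xs → f x ≤ maximum f xs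
≤-maximum f (y ∷ xs) (here refl)  = ℚ.p≤p⊔q (f y) (maximum f xs)
≤-maximum f (y ∷ xs) (there x∈xs) =
  ℚ.≤-trans (≤-maximum f xs x∈xs) (ℚ.p≤q⊔p (f y) (maximum f xs))

-- The default 0ℚ of the fold is only harmless for nonnegative f.
maximum-attained : ∀ {A : Set} (f : A → ℚ) → (∀ x → 0ℚ ≤ f x) →
                   ∀ {x} xs → x ∈ xs → ∃ λ y → y ∈ xs × f y ≡ maximum f xs
maximum-attained f f≥0 (y ∷ []) _ = y , here refl , sym (ℚ.p≥q⇒p⊔q≡p (f≥0 y))
maximum-attained f f≥0 (y ∷ z ∷ xs) _
  with maximum-attained f f≥0 (z ∷ xs) (here refl) | f y ℚ.≤? maximum f (z ∷ xs)
... | t , t∈ , ft | yes fy≤m = t , there t∈ , trans ft (sym (ℚ.p≤q⇒p⊔q≡q fy≤m))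
... | _           | no fy≰m  = y , here refl , sym (ℚ.p≥q⇒p⊔q≡p (ℚ.<⇒≤ (ℚ.≰⇒> fy≰m)))

sum-map-mono : ∀ {A : Set} (f g : A → ℕ) → (∀ x → g x ℕ.≤ f x) →
               ∀ xs → sum (map g xs) ℕ.≤ sum (map f xs)
sum-map-mono f g g≤f []       = z≤n
sum-map-mono f g g≤f (x ∷ xs) = ℕ.+-mono-≤ (g≤f x) (sum-map-mono f g g≤f xs)

sum-map-mono-< : ∀ {A : Set} (f g : A → ℕ) → (∀ x → g x ℕ.≤ f x) →
                 ∀ {y} xs → y ∈ xs → g y ℕ.< f y → sum (map g xs) ℕ.< sum (map f xs)
sum-map-mono-< f g g≤f (x ∷ xs) (here refl) gx<fx = ℕ.+-mono-<-≤ gx<fx (sum-map-mono f g g≤f xs)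
sum-map-mono-< f g g≤f (x ∷ xs) (there y∈xs) gy<fy =
  ℕ.+-mono-≤-< (g≤f x) (sum-map-mono-< f g g≤f xs y∈xs gy<fy)

_≟ₛ_ : (s t : Strategy) → Dec (s ≡ t)
C ≟ₛ C = yes refl
C ≟ₛ D = no λ ()
D ≟ₛ C = no λ ()
D ≟ₛ D = yes refl

∧-true⇒ˡ : ∀ {a b} → a ∧ b ≡ true → a ≡ true
∧-true⇒ˡ {true} _ = refl

∧-true⇒ʳ : ∀ {a b} → a ∧ b ≡ true → b ≡ true
∧-true⇒ʳ {true} b≡true = b≡true

isD-true : ∀ {s} → isD s ≡ true → s ≡ D
isD-true {D} _ = refl

C≢D : C ≢ D
C≢D ()

module Neighbourhood {n : ℕ} (G : Graph n) where

  deg : Fin n → ℕ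
  deg v = count (adj G v)

  nbrs : (Strategy → Bool) → Configuration n → Fin n → ℕ
  nbrs p c v = count (λ u → adj G v u ∧ p (c u))

  nbrs-< : ∀ p c {v u} → adj G v u ≡ true → p (c u) ≡ false → nbrs p c v ℕ.< deg v
  nbrs-< p c {v} {u} vu pu = countIn-mono-< (λ x → adj G v x ∧ p (c x)) (adj G v)
    (λ _ → ∧-true⇒ˡ) (allFin n) (∈-allFin u) vu (trans (cong (adj G v u ∧_) pu) (Bool.∧-zeroʳ _))

  numC-of-D : ∀ c v → c v ≡ D → numC G c v ≡ nbrs isC c v
  numC-of-D c v cv = cong (λ s → (Bool.if isC s then 1 else 0) ℕ.+ nbrs isC c v) cv

  numC-of-C : ∀ c v → c v ≡ C → numC G c v ≡ suc (nbrs isC c v)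
  numC-of-C c v cv = cong (λ s → (Bool.if isC s then 1 else 0) ℕ.+ nbrs isC c v) cv

  adj-sym : ∀ {u v} → adj G u v ≡ true → adj G v u ≡ true
  adj-sym {u} {v} uv = trans (Graph.sym G v u) uv

  ∈-closedNbhd-self : ∀ v → v ∈ closedNbhd G v
  ∈-closedNbhd-self v = ∈-filter⁺ _ (∈-allFin v)
    (cong (_∨ adj G v v) (to Bool.T-≡ (fromWitness {a? = v Fin.≟ v} refl)))

  ∈-closedNbhd⁻ : ∀ {u v} → u ∈ closedNbhd G v → u ≡ v ⊎ adj G v u ≡ true
  ∈-closedNbhd⁻ {u} {v} u∈N with u Fin.≟ v | proj₂ (∈-filter⁻ (λ x → (⌊ x Fin.≟ v ⌋ ∨ adj G v x) Bool.≟ true) {xs = allFin n} u∈N)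
  ... | yes u≡v | _  = inj₁ u≡v
  ... | no _    | vu = inj₂ vu

  adj-of-∈-closedNbhd : ∀ (c : Configuration n) {u v} → u ∈ closedNbhd G v → c u ≢ c v → adj G v u ≡ true
  adj-of-∈-closedNbhd c u∈N cu≢cv with ∈-closedNbhd⁻ u∈N
  ... | inj₁ u≡v = contradiction (cong c u≡v) cu≢cv
  ... | inj₂ vu  = vu

module Process {n : ℕ} (G : Graph n) (w : ℚ) where
  open Neighbourhood G

  data PowerView (c : Configuration n) (v : Fin n) : ℚ → Set where
    C-wins  : c v ≡ C → w < ratioC G c v → PowerView c v ((+ 1) / suc (nbrs isC c v))
    C-loses : c v ≡ C → ¬ w < ratioC G c v → PowerView c v 0ℚ
    D-wins  : c v ≡ D → ratioC G c v ≤ w → PowerView c v ((+ 1) / suc (nbrs isD c v))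
    D-loses : c v ≡ D → ¬ ratioC G c v ≤ w → PowerView c v 0ℚ

  powerView : ∀ c v → PowerView c v (power G w c v)
  powerView c v with c v in cv
  ... | C with w ℚ.<? ratioC G c v
  ...   | yes r = C-wins cv r
  ...   | no ¬r = C-loses cv ¬r
  powerView c v | D with ratioC G c v ℚ.≤? w
  ...   | yes r = D-wins cv r
  ...   | no ¬r = D-loses cv ¬r

  power-nonneg : ∀ c v → 0ℚ ≤ power G w c v
  power-nonneg c v = nonneg (powerView c v)
    where
      nonneg : ∀ {q} → PowerView c v q → 0ℚ ≤ q
      nonneg (C-wins _ _)  = frac-nonneg 1 (suc (nbrs isC c v))
      nonneg (C-loses _ _) = ℚ.≤-refl
      nonneg (D-wins _ _)  = frac-nonneg 1 (suc (nbrs isD c v))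
      nonneg (D-loses _ _) = ℚ.≤-refl

  power-of-winning-C : ∀ c v → c v ≡ C → w < ratioC G c v →
                       power G w c v ≡ (+ 1) / suc (nbrs isC c v)
  power-of-winning-C c v cv r = go (powerView c v)
    where
      go : ∀ {q} → PowerView c v q → q ≡ (+ 1) / suc (nbrs isC c v)
      go (C-wins _ _)    = refl
      go (C-loses _ ¬r)  = contradiction r ¬r
      go (D-wins cv′ _)  = contradiction (trans (sym cv) cv′) C≢D
      go (D-loses cv′ _) = contradiction (trans (sym cv) cv′) C≢D

  power-of-losing-C : ∀ c v → c v ≡ C → ¬ w < ratioC G c v → power G w c v ≡ 0ℚ
  power-of-losing-C c v cv ¬r = go (powerView c v)
    where
      go : ∀ {q} → PowerView c v q → q ≡ 0ℚ
      go (C-wins _ r)    = contradiction r ¬r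
      go (C-loses _ _)   = refl
      go (D-wins cv′ _)  = contradiction (trans (sym cv) cv′) C≢D
      go (D-loses cv′ _) = contradiction (trans (sym cv) cv′) C≢D

  power-of-winning-D : ∀ c v → c v ≡ D → ratioC G c v ≤ w →
                       power G w c v ≡ (+ 1) / suc (nbrs isD c v)
  power-of-winning-D c v cv r = go (powerView c v)
    where
      go : ∀ {q} → PowerView c v q → q ≡ (+ 1) / suc (nbrs isD c v)
      go (C-wins cv′ _)  = contradiction (trans (sym cv′) cv) C≢D
      go (C-loses cv′ _) = contradiction (trans (sym cv′) cv) C≢D
      go (D-wins _ _)    = refl
      go (D-loses _ ¬r)  = contradiction r ¬r

  power-of-losing-D : ∀ c v → c v ≡ D → ¬ ratioC G c v ≤ w → power G w c v ≡ 0ℚ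
  power-of-losing-D c v cv ¬r = go (powerView c v)
    where
      go : ∀ {q} → PowerView c v q → q ≡ 0ℚ
      go (C-wins cv′ _)  = contradiction (trans (sym cv′) cv) C≢D
      go (C-loses cv′ _) = contradiction (trans (sym cv′) cv) C≢D
      go (D-wins _ r)    = contradiction r ¬r
      go (D-loses _ _)   = refl

  ≤-maxPower : ∀ c {u v} → u ∈ closedNbhd G v → power G w c u ≤ maxPower G w c v
  ≤-maxPower c = ≤-maximum (power G w c) _

  maxPower-attained : ∀ c v → ∃ λ u → u ∈ closedNbhd G v × power G w c u ≡ maxPower G w c v
  maxPower-attained c v = maximum-attained (power G w c) (power-nonneg c) _ (∈-closedNbhd-self v)

  maxHolds-intro : ∀ c v (p : Strategy → Bool) {u} → u ∈ closedNbhd G v →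
                   power G w c u ≡ maxPower G w c v → p (c u) ≡ true → maxHolds G w c v p ≡ true
  maxHolds-intro c v p u∈N pu pcu = to Bool.T-≡ (any⁺ _ (lose u∈N
    (from Bool.T-∧ (fromWitness pu , from Bool.T-≡ pcu))))

  maxHolds-elim : ∀ c v (p : Strategy → Bool) → maxHolds G w c v p ≡ true →
                  ∃ λ u → u ∈ closedNbhd G v × power G w c u ≡ maxPower G w c v × p (c u) ≡ true
  maxHolds-elim c v p held with find (any⁻ _ (closedNbhd G v) (from Bool.T-≡ held))
  ... | u , u∈N , both with to Bool.T-∧ both
  ...   | pu , pcu = u , u∈N , toWitness pu , to Bool.T-≡ pcu

  step-D-held : ∀ c v → c v ≡ D → maxHolds G w c v isD ≡ true → step G w c v ≡ D
  step-D-held c v cv held with maxHolds G w c v isC | maxHolds G w c v isD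
  ... | false | true = refl
  ... | true  | true = cv

  step-C→D : ∀ c v → c v ≡ C → step G w c v ≡ D →
             maxHolds G w c v isC ≡ false × maxHolds G w c v isD ≡ true
  step-C→D c v cv sv with maxHolds G w c v isC | maxHolds G w c v isD
  ... | true  | false = contradiction sv λ ()
  ... | false | true  = refl , refl
  ... | true  | true  = contradiction (trans (sym cv) sv) C≢D
  ... | false | false = contradiction (trans (sym cv) sv) C≢D

  process-suc : ∀ c i → process G w c (suc i) ≡ process G w (step G w c) i
  process-suc c zero    = refl
  process-suc c (suc i) = cong (step G w) (process-suc c i)

  stable-if-potential-decreases : (Φ : Configuration n → ℕ) →
    (∀ c v → c v ≢ step G w c v → Φ (step G w c) ℕ.< Φ c) → ∀ c → BecomesStable G w c
  stable-if-potential-decreases Φ Φ-decreases c = within (suc (Φ c)) c ℕ.≤-refl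
    where
      within : ∀ m c → Φ c ℕ.< m → BecomesStable G w c
      within (suc m) c Φc<m with Fin.all? (λ v → c v ≟ₛ step G w c v)
      ... | yes fixed = 0 , fixed
      ... | no ¬fixed
        with v , cv≢ ← Fin.¬∀⟶∃¬ n _ (λ v → c v ≟ₛ step G w c v) ¬fixed
        with i , stable ← within m (step G w c) (ℕ.<-≤-trans (Φ-decreases c v cv≢) (ℕ.≤-pred Φc<m))
        = suc i , λ u → trans (cong (λ c′ → c′ u) (process-suc c i))
                          (trans (stable u) (cong (λ c′ → c′ u) (sym (process-suc c (suc i)))))

module WinCondition {n : ℕ} (G : Graph n) (w : ℚ) (H : InLastTwoParts G w) where
  open Neighbourhood G

  ½≤w : ½ ≤ w
  ½≤w = proj₁ H

  largest-∈S : ∀ v → InS G ((+ closedDeg G v) / closedDeg G v)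
  largest-∈S v = v , closedDeg G v , ℕ.m≤m+n (closedDeg G v) _ , ℕ.≤-refl , refl

  second-largest-∈S : ∀ v → 1 ℕ.≤ deg v → InS G ((+ deg v) / closedDeg G v)
  second-largest-∈S v 1≤d = v , deg v , suc≤double , ℕ.n≤1+n (deg v) , refl
    where
      suc≤double : suc (deg v) ℕ.≤ 2 ℕ.* deg v
      suc≤double = subst (suc (deg v) ℕ.≤_) (cong (deg v ℕ.+_) (sym (ℕ.+-identityʳ (deg v))))
                     (ℕ.+-monoˡ-≤ (deg v) 1≤d)

  ≤w-if-below-second-largest : ∀ {t} v → InS G t → 1 ℕ.≤ deg v →
                               t < (+ deg v) / closedDeg G v → t ≤ w
  ≤w-if-below-second-largest v t∈S 1≤d t<s = proj₂ (proj₂ H) _ t∈S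
    (_ , _ , second-largest-∈S v 1≤d , largest-∈S v , t<s ,
     frac-monoˡ-< (closedDeg G v) (ℕ.n<1+n (deg v)))

  <½-or-∈S : ∀ v j → j ℕ.≤ closedDeg G v →
             (+ j) / closedDeg G v < ½ ⊎ InS G ((+ j) / closedDeg G v)
  <½-or-∈S v j j≤d = by-cases (closedDeg G v ℕ.≤? 2 ℕ.* j)
    where
      -- Not a with: abstracting closedDeg G v under the NonZero instance of _/_ is very costly.
      by-cases : Dec (closedDeg G v ℕ.≤ 2 ℕ.* j) →
                 (+ j) / closedDeg G v < ½ ⊎ InS G ((+ j) / closedDeg G v)
      by-cases (yes d≤2j) = inj₂ (v , j , d≤2j , j≤d , refl)
      by-cases (no d≰2j)  = inj₁ (frac<½ j (closedDeg G v) d≰2j)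

  ≤w-if-numerator<deg : ∀ v j → j ℕ.< deg v → (+ j) / closedDeg G v ≤ w
  ≤w-if-numerator<deg v j j<d =
    [ (λ j/d<½ → ℚ.<⇒≤ (ℚ.<-≤-trans j/d<½ ½≤w))
    , (λ j/d∈S → ≤w-if-below-second-largest v j/d∈S (ℕ.≤-trans (s≤s z≤n) j<d)
                   (frac-monoˡ-< (closedDeg G v) j<d))
    ]′ (<½-or-∈S v j (ℕ.m≤n⇒m≤1+n (ℕ.<⇒≤ j<d)))

  deg≤-if-w<deg/closedDeg : ∀ u v → w < (+ deg u) / closedDeg G u → deg v ℕ.≤ deg u
  deg≤-if-w<deg/closedDeg u v w<r = ℕ.≮⇒≥ λ du<dv → ℚ.<-irrefl refl
    ([ (λ r<½ → ℚ.<-trans w<r (ℚ.<-≤-trans r<½ ½≤w))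
     , (λ r∈S → ℚ.<-≤-trans w<r (≤w-if-below-second-largest v r∈S (ℕ.≤-trans (s≤s z≤n) du<dv)
                                  (n/suc-n-strictMono du<dv)))
     ]′ (<½-or-∈S u (deg u) (ℕ.n≤1+n (deg u))))

module Dynamics {n : ℕ} (G : Graph n) (w : ℚ) (H : InLastTwoParts G w) where
  open Neighbourhood G
  open Process G w
  open WinCondition G w H

  DefectorsWin : Configuration n → Fin n → Set
  DefectorsWin c v = ratioC G c v ≤ w

  defectors-win-if-numC<deg : ∀ c v → numC G c v ℕ.< deg v → DefectorsWin c v
  defectors-win-if-numC<deg c v = ≤w-if-numerator<deg v (numC G c v)

  defector-with-defecting-nbr-wins : ∀ c {v u} → c v ≡ D → adj G v u ≡ true → c u ≡ D →
                                     DefectorsWin c v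
  defector-with-defecting-nbr-wins c {v} cv vu cu = defectors-win-if-numC<deg c v
    (subst (ℕ._< deg v) (sym (numC-of-D c v cv)) (nbrs-< isC c vu (cong isC cu)))

  winning-collaborator-with-defecting-nbr-full : ∀ c {u v} → c u ≡ C → w < ratioC G c u →
    adj G u v ≡ true → c v ≡ D → numC G c u ≡ deg u
  winning-collaborator-with-defecting-nbr-full c {u} cu w<r uv cv = ℕ.≤∧≮⇒≡ numC≤deg
    λ numC<deg → ℚ.<-irrefl refl (ℚ.<-≤-trans w<r (defectors-win-if-numC<deg c u numC<deg))
    where
      numC≤deg : numC G c u ℕ.≤ deg u
      numC≤deg = subst (ℕ._≤ deg u) (sym (numC-of-C c u cu)) (nbrs-< isC c uv (cong isC cv))

  collaborator-power-≤ : ∀ c {v u} → c v ≡ D → DefectorsWin c v → c u ≡ C → adj G v u ≡ true →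
                         power G w c u ≤ power G w c v
  collaborator-power-≤ c {v} {u} cv dw cu vu = by-cases (w ℚ.<? ratioC G c u)
    where
      open ℚ.≤-Reasoning
      by-cases : Dec (w < ratioC G c u) → power G w c u ≤ power G w c v
      by-cases (no ¬w<r) = begin
        power G w c u              ≡⟨ power-of-losing-C c u cu ¬w<r ⟩
        0ℚ                         ≤⟨ frac-nonneg 1 (suc (nbrs isD c v)) ⟩
        (+ 1) / suc (nbrs isD c v) ≡⟨ power-of-winning-D c v cv dw ⟨
        power G w c v              ∎
      by-cases (yes w<r) = begin
        power G w c u              ≡⟨ power-of-winning-C c u cu w<r ⟩
        (+ 1) / suc (nbrs isC c u) ≤⟨ 1/suc-antitone nD≤nC ⟩
        (+ 1) / suc (nbrs isD c v) ≡⟨ power-of-winning-D c v cv dw ⟨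
        power G w c v              ∎
        where
          full : numC G c u ≡ deg u
          full = winning-collaborator-with-defecting-nbr-full c cu w<r (adj-sym vu) cv
          deg-v≤deg-u : deg v ℕ.≤ deg u
          deg-v≤deg-u = deg≤-if-w<deg/closedDeg u v (subst (λ j → w < (+ j) / closedDeg G u) full w<r)
          nD≤nC : nbrs isD c v ℕ.≤ nbrs isC c u
          nD≤nC = ℕ.≤-pred (ℕ.≤-trans (nbrs-< isD c vu (cong isD cu))
                    (ℕ.≤-trans deg-v≤deg-u (ℕ.≤-reflexive (trans (sym full) (numC-of-C c u cu)))))

  winning-defector-stays : ∀ c v → c v ≡ D → DefectorsWin c v → step G w c v ≡ D
  winning-defector-stays c v cv dw = step-D-held c v cv (D-held (maxPower-attained c v))
    where
      D-held : (∃ λ y → y ∈ closedNbhd G v × power G w c y ≡ maxPower G w c v) →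
               maxHolds G w c v isD ≡ true
      D-held (y , y∈N , py) = by-strategy (c y) refl
        where
          by-strategy : ∀ s → c y ≡ s → maxHolds G w c v isD ≡ true
          by-strategy D cy = maxHolds-intro c v isD y∈N py (cong isD cy)
          by-strategy C cy = maxHolds-intro c v isD (∈-closedNbhd-self v) pv-max (cong isD cv)
            where
              vy : adj G v y ≡ true
              vy = adj-of-∈-closedNbhd c y∈N λ cy≡cv → C≢D (trans (sym cy) (trans cy≡cv cv))
              pv-max : power G w c v ≡ maxPower G w c v
              pv-max = ℚ.≤-antisym (≤-maxPower c (∈-closedNbhd-self v))
                         (ℚ.≤-trans (ℚ.≤-reflexive (sym py)) (collaborator-power-≤ c cv dw cy vy))

  winning-defector-keeps-winning : ∀ c v → c v ≡ D → DefectorsWin c v → DefectorsWin (step G w c) v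
  winning-defector-keeps-winning c v cv dw =
    ℚ.≤-trans (frac-monoˡ-≤ (closedDeg G v) numC-step≤numC) dw
    where
      was-C : ∀ x s → c x ≡ s → adj G v x ≡ true → isC (step G w c x) ≡ true → isC s ≡ true
      was-C x C _  _  _   = refl
      was-C x D cx vx sxC = contradiction (trans (sym sxC) (cong isC (winning-defector-stays c x cx
                              (defector-with-defecting-nbr-wins c cx (adj-sym vx) cv)))) λ ()
      numC-step≤numC : numC G (step G w c) v ℕ.≤ numC G c v
      numC-step≤numC = subst₂ ℕ._≤_
        (sym (numC-of-D (step G w c) v (winning-defector-stays c v cv dw))) (sym (numC-of-D c v cv))
        (countIn-mono _ _ (λ x vx∧sxC → cong₂ _∧_ (∧-true⇒ˡ vx∧sxC)
                             (was-C x (c x) refl (∧-true⇒ˡ vx∧sxC) (∧-true⇒ʳ vx∧sxC))) (allFin n))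

  defecting-collaborator-wins : ∀ c u → c u ≡ C → step G w c u ≡ D → DefectorsWin (step G w c) u
  defecting-collaborator-wins c u cu su = from-D-holder (maxHolds-elim c u isD D-held)
    where
      C-not-held : maxHolds G w c u isC ≡ false
      C-not-held = proj₁ (step-C→D c u cu su)
      D-held : maxHolds G w c u isD ≡ true
      D-held = proj₂ (step-C→D c u cu su)
      from-D-holder : (∃ λ y → y ∈ closedNbhd G u × power G w c y ≡ maxPower G w c u × isD (c y) ≡ true) →
                      DefectorsWin (step G w c) u
      from-D-holder (y , y∈N , py , Dy) = defector-with-defecting-nbr-wins (step G w c) su uy
                                            (winning-defector-stays c y cy (y-wins (ratioC G c y ℚ.≤? w)))
        where
          cy : c y ≡ D
          cy = isD-true Dy
          uy : adj G u y ≡ true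
          uy = adj-of-∈-closedNbhd c y∈N λ cy≡cu → C≢D (trans (sym cu) (trans (sym cy≡cu) cy))
          -- A losing defector has power 0, so it could only hold the maximum jointly with u.
          y-wins : Dec (DefectorsWin c y) → DefectorsWin c y
          y-wins (yes dw) = dw
          y-wins (no ¬dw) = contradiction (trans (sym C-held) C-not-held) λ ()
            where
              pu-max : power G w c u ≡ maxPower G w c u
              pu-max = ℚ.≤-antisym (≤-maxPower c (∈-closedNbhd-self u))
                         (ℚ.≤-trans (ℚ.≤-reflexive (trans (sym py) (power-of-losing-D c y cy ¬dw)))
                                    (power-nonneg c u))
              C-held : maxHolds G w c u isC ≡ true
              C-held = maxHolds-intro c u isC (∈-closedNbhd-self u) pu-max (cong isC cu)

-- The decided proposition is "defectors win at the vertex".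
weight : ∀ {A : Set} → Strategy → Dec A → ℕ
weight C _       = 1
weight D (yes _) = 0
weight D (no _)  = 2

weight-step : ∀ {A B : Set} s s′ (a? : Dec A) (b? : Dec B) →
              (s ≡ C → s′ ≡ D → B) → (s ≡ D → A → s′ ≡ D) → (s ≡ D → A → B) →
              weight s′ b? ℕ.≤ weight s a? × (s ≢ s′ → weight s′ b? ℕ.< weight s a?)
weight-step C C _       _       _        _    _    = ℕ.≤-refl , λ s≢s → contradiction refl s≢s
weight-step C D _       (yes _) _        _    _    = z≤n , λ _ → s≤s z≤n
weight-step C D _       (no ¬b) defect-b _    _    = contradiction (defect-b refl refl) ¬b
weight-step D C (yes a) _       _        stay _    = contradiction (stay refl a) λ ()
weight-step D C (no _)  _       _        _    _    = s≤s z≤n , λ _ → s≤s (s≤s z≤n)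
weight-step D D (yes _) (yes _) _        _    _    = z≤n , λ s≢s → contradiction refl s≢s
weight-step D D (yes a) (no ¬b) _        _    keep = contradiction (keep refl a) ¬b
weight-step D D (no _)  (yes _) _        _    _    = z≤n , λ s≢s → contradiction refl s≢s
weight-step D D (no _)  (no _)  _        _    _    = ℕ.≤-refl , λ s≢s → contradiction refl s≢s

module Potential {n : ℕ} (G : Graph n) (w : ℚ) (H : InLastTwoParts G w) where
  open Dynamics G w H

  vertexWeight : Configuration n → Fin n → ℕ
  vertexWeight c v = weight (c v) (ratioC G c v ℚ.≤? w)

  totalWeight : Configuration n → ℕ
  totalWeight c = sum (map (vertexWeight c) (allFin n))

  vertexWeight-step : ∀ c v → vertexWeight (step G w c) v ℕ.≤ vertexWeight c v ×
                              (c v ≢ step G w c v → vertexWeight (step G w c) v ℕ.< vertexWeight c v)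
  vertexWeight-step c v = weight-step (c v) (step G w c v) _ _
    (defecting-collaborator-wins c v) (winning-defector-stays c v) (winning-defector-keeps-winning c v)

  totalWeight-decreases : ∀ c v → c v ≢ step G w c v → totalWeight (step G w c) ℕ.< totalWeight c
  totalWeight-decreases c v cv≢ = sum-map-mono-< (vertexWeight c) (vertexWeight (step G w c))
    (λ x → proj₁ (vertexWeight-step c x)) (allFin n) (∈-allFin v) (proj₂ (vertexWeight-step c v) cv≢)

mainTheorem6 : ∀ {n : ℕ} (G : Graph n) (w : ℚ) → InLastTwoParts G w →
    (C₀ : Configuration n) → BecomesStable G w C₀
mainTheorem6 G w H = Process.stable-if-potential-decreases G w
  (Potential.totalWeight G w H) (Potential.totalWeight-decreases G w H)
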